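{- Let $p$ be an odd prime and let $\mathcal{H}^{\mathrm{nil}}$ be as in the context. Then $\mathcal{H}^{\mathrm{nil}}$ is a free $Z(\mathcal{H}^{\mathrm{nil}})$-module with basis $1,\ S,\ U,\ SU$.
   Context: Let $\mathcal{H}^{\mathrm{nil}}$ be the $\mathbb{F}_p$-algebra generated by $S$, $U$, $U^{ -1}$ with relations $$UU^{ -1}=U^{ -1}U=1,\qquad S^2=0,\qquad U^2S=SU^2.$$ Its center is $Z(\mathcal{H}^{\mathrm{nil}})=\mathbb{F}_p[\zeta_1,\zeta_2^{\pm1}]$, where $$\zeta_1=US+SU,\qquad \zeta_2=U^2.$$ -}

module Defs where

open import Data.Nat using (ℕ; zero; suc)

data Tm : Set where
  S U U⁻¹ : Tm
  𝟘 𝟙     : Tm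
  _⊕_ _⊗_ : Tm → Tm → Tm
  ⊝_      : Tm → Tm

infixl 6 _⊕_
infixl 7 _⊗_
infix  8 ⊝_

nat : ℕ → Tm
nat zero    = 𝟘
nat (suc n) = 𝟙 ⊕ nat n

-- The congruence defining H^nil over F_p: the smallest congruence containing
-- the (associative, unital) ring axioms, characteristic p (p·1 = 0, so the
-- ring is an F_p-algebra, scalars being the n·1), and the relations
-- U U⁻¹ = U⁻¹ U = 1, S² = 0, U² S = S U².
-- So  Tm / ≈[ p ]  is the F_p-algebra H^nil.
infix 4 _≈[_]_
data _≈[_]_ : Tm → ℕ → Tm → Set where
  ≈-refl  : ∀ {p x} → x ≈[ p ] x
  ≈-sym   : ∀ {p x y} → x ≈[ p ] y → y ≈[ p ] x
  ≈-trans : ∀ {p x y z} → x ≈[ p ] y → y ≈[ p ] z → x ≈[ p ] z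
  ⊕-cong  : ∀ {p x x' y y'} → x ≈[ p ] x' → y ≈[ p ] y' → x ⊕ y ≈[ p ] x' ⊕ y'
  ⊗-cong  : ∀ {p x x' y y'} → x ≈[ p ] x' → y ≈[ p ] y' → x ⊗ y ≈[ p ] x' ⊗ y'
  ⊝-cong  : ∀ {p x x'} → x ≈[ p ] x' → ⊝ x ≈[ p ] ⊝ x'
  ⊕-assoc : ∀ {p x y z} → (x ⊕ y) ⊕ z ≈[ p ] x ⊕ (y ⊕ z)
  ⊕-comm  : ∀ {p x y} → x ⊕ y ≈[ p ] y ⊕ x
  ⊕-idˡ   : ∀ {p x} → 𝟘 ⊕ x ≈[ p ] x
  ⊝-invˡ  : ∀ {p x} → (⊝ x) ⊕ x ≈[ p ] 𝟘
  ⊗-assoc : ∀ {p x y z} → (x ⊗ y) ⊗ z ≈[ p ] x ⊗ (y ⊗ z)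
  ⊗-idˡ   : ∀ {p x} → 𝟙 ⊗ x ≈[ p ] x
  ⊗-idʳ   : ∀ {p x} → x ⊗ 𝟙 ≈[ p ] x
  distribˡ : ∀ {p x y z} → x ⊗ (y ⊕ z) ≈[ p ] (x ⊗ y) ⊕ (x ⊗ z)
  distribʳ : ∀ {p x y z} → (y ⊕ z) ⊗ x ≈[ p ] (y ⊗ x) ⊕ (z ⊗ x)
  char    : ∀ {p} → nat p ≈[ p ] 𝟘
  UU⁻¹    : ∀ {p} → U ⊗ U⁻¹ ≈[ p ] 𝟙
  U⁻¹U    : ∀ {p} → U⁻¹ ⊗ U ≈[ p ] 𝟙
  SS      : ∀ {p} → S ⊗ S ≈[ p ] 𝟘
  UUS     : ∀ {p} → (U ⊗ U) ⊗ S ≈[ p ] S ⊗ (U ⊗ U)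

ζ₁ ζ₂ ζ₂⁻¹ : Tm
ζ₁   = U ⊗ S ⊕ S ⊗ U
ζ₂   = U ⊗ U
ζ₂⁻¹ = U⁻¹ ⊗ U⁻¹

-- Terms of the commutative subalgebra F_p[ζ₁, ζ₂^{±1}] = Z(H^nil)
-- (the subring generated by ζ₁, ζ₂, ζ₂⁻¹; scalars are the n·1).
data ZTm : Set where
  z₁ z₂ z₂⁻¹ : ZTm
  z𝟘 z𝟙      : ZTm
  _z⊕_ _z⊗_  : ZTm → ZTm → ZTm
  z⊝_        : ZTm → ZTm

⟦_⟧ : ZTm → Tm
⟦ z₁ ⟧      = ζ₁
⟦ z₂ ⟧      = ζ₂
⟦ z₂⁻¹ ⟧    = ζ₂⁻¹
⟦ z𝟘 ⟧      = 𝟘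
⟦ z𝟙 ⟧      = 𝟙
⟦ a z⊕ b ⟧  = ⟦ a ⟧ ⊕ ⟦ b ⟧
⟦ a z⊗ b ⟧  = ⟦ a ⟧ ⊗ ⟦ b ⟧
⟦ z⊝ a ⟧    = ⊝ ⟦ a ⟧

lin : ZTm → ZTm → ZTm → ZTm → Tm
lin a b c d = ⟦ a ⟧ ⊗ 𝟙 ⊕ ⟦ b ⟧ ⊗ S ⊕ ⟦ c ⟧ ⊗ U ⊕ ⟦ d ⟧ ⊗ (S ⊗ U)

module Submission where

-- The proof is the regular-representation argument.  Write H for the ring
-- Tm / ≈[ p ] and V for the coordinate vectors (v₀, v₁, v₂, v₃) of central
-- terms, read as the element v₀ + v₁S + v₂U + v₃SU of H (the map 'combine').
--   1. H is a ring, and ζ₁, ζ₂, ζ₂⁻¹ are central: an element commuting with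
--      the generators S and U commutes with everything.
--   2. From S² = 0, US = ζ₁ − SU and U² = ζ₂, left multiplication by S and
--      by U on the basis is given by explicit matrices over Z.  Extending
--      them multiplicatively gives an action of terms on V which respects
--      ≈[ p ]; the only relations needing thought are U²S = SU² and
--      UU⁻¹ = U⁻¹U = 1, which hold because U acting twice is scaling by ζ₂.
--   3. Spanning: combine (act h v) ≈ h · combine v, so h ≈ combine (act h e₀).
--   4. Independence: act (a + bS + cU + dSU) e₀ has coordinates (a, b, c, d),
--      so a relation a + bS + cU + dSU ≈ 0 forces a, b, c, d ≈ 0.
-- The argument works for every characteristic p.

open import Defs
open import Data.Nat using (ℕ; zero; suc)
open import Data.Nat.Primality using (Prime)
open import Data.Product using (Σ; _×_; _,_)
open import Level using (0ℓ)
open import Algebra.Bundles using (Ring)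
open import Relation.Binary.PropositionalEquality as ≡ using (_≡_; _≢_)

module Hnil (p : ℕ) where

  H : Ring 0ℓ 0ℓ
  H = record
    { Carrier = Tm ; _≈_ = λ x y → x ≈[ p ] y
    ; _+_ = _⊕_ ; _*_ = _⊗_ ; -_ = ⊝_ ; 0# = 𝟘 ; 1# = 𝟙
    ; isRing = record
      { +-isAbelianGroup = record
        { isGroup = record
          { isMonoid = record
            { isSemigroup = record
              { isMagma = record
                { isEquivalence = record { refl = ≈-refl ; sym = ≈-sym ; trans = ≈-trans }
                ; ∙-cong = ⊕-cong }
              ; assoc = λ _ _ _ → ⊕-assoc }
            ; identity = (λ _ → ⊕-idˡ) , (λ _ → ≈-trans ⊕-comm ⊕-idˡ) }
          ; inverse = (λ _ → ⊝-invˡ) , (λ _ → ≈-trans ⊕-comm ⊝-invˡ)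
          ; ⁻¹-cong = ⊝-cong }
        ; comm = λ _ _ → ⊕-comm }
      ; *-cong = ⊗-cong
      ; *-assoc = λ _ _ _ → ⊗-assoc
      ; *-identity = (λ _ → ⊗-idˡ) , (λ _ → ⊗-idʳ)
      ; distrib = (λ _ _ _ → distribˡ) , (λ _ _ _ → distribʳ) } }

  open Ring H hiding (zero; distribˡ; distribʳ)
  open import Algebra.Properties.Ring H using (-‿distribˡ-*; -‿distribʳ-*; -‿involutive; -‿+-comm; -0#≈0#)
  open import Relation.Binary.Reasoning.Setoid setoid
  open import Algebra.Solver.CommutativeMonoid +-commutativeMonoid
    using (solve; _⊜_; id) renaming (_⊕_ to _⊞_)

  cancelˡ : ∀ a b → ⊝ a ⊕ (a ⊕ b) ≈ b
  cancelˡ a b = begin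
    ⊝ a ⊕ (a ⊕ b)  ≈⟨ sym ⊕-assoc ⟩
    (⊝ a ⊕ a) ⊕ b  ≈⟨ ⊕-cong ⊝-invˡ ≈-refl ⟩
    𝟘 ⊕ b          ≈⟨ ⊕-idˡ ⟩
    b              ∎

  cancelʳ : ∀ a b → (a ⊕ b) ⊕ ⊝ b ≈ a
  cancelʳ a b = begin
    (a ⊕ b) ⊕ ⊝ b  ≈⟨ ⊕-assoc ⟩
    a ⊕ (b ⊕ ⊝ b)  ≈⟨ ⊕-cong ≈-refl (-‿inverseʳ b) ⟩
    a ⊕ 𝟘          ≈⟨ +-identityʳ a ⟩
    a              ∎

  ⊕-interchange : ∀ w x y z → (w ⊕ x) ⊕ (y ⊕ z) ≈ (w ⊕ y) ⊕ (x ⊕ z)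
  ⊕-interchange = solve 4 (λ w x y z → (w ⊞ x) ⊞ (y ⊞ z) ⊜ (w ⊞ y) ⊞ (x ⊞ z)) refl

  sum₄-cong : ∀ {A B C D A' B' C' D'} → A ≈ A' → B ≈ B' → C ≈ C' → D ≈ D' →
              ((A ⊕ B) ⊕ C) ⊕ D ≈ ((A' ⊕ B') ⊕ C') ⊕ D'
  sum₄-cong a b c d = ⊕-cong (⊕-cong (⊕-cong a b) c) d

  distrib₄ : ∀ x a b c d → x ⊗ (((a ⊕ b) ⊕ c) ⊕ d) ≈ ((x ⊗ a ⊕ x ⊗ b) ⊕ x ⊗ c) ⊕ x ⊗ d
  distrib₄ x a b c d = trans distribˡ (⊕-cong (trans distribˡ (⊕-cong distribˡ ≈-refl)) ≈-refl)

  SSx≈0 : ∀ x → S ⊗ (S ⊗ x) ≈ 𝟘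
  SSx≈0 x = trans (sym ⊗-assoc) (trans (⊗-cong SS ≈-refl) (zeroˡ x))

  xSS≈0 : ∀ x → (x ⊗ S) ⊗ S ≈ 𝟘
  xSS≈0 x = trans ⊗-assoc (trans (⊗-cong ≈-refl SS) (zeroʳ x))

  Commute : Tm → Tm → Set
  Commute x y = x ⊗ y ≈ y ⊗ x

  commute-𝟘 : ∀ z → Commute z 𝟘
  commute-𝟘 z = trans (zeroʳ z) (sym (zeroˡ z))

  commute-𝟙 : ∀ z → Commute z 𝟙
  commute-𝟙 z = trans ⊗-idʳ (sym ⊗-idˡ)

  commute-⊕ : ∀ {z x y} → Commute z x → Commute z y → Commute z (x ⊕ y)
  commute-⊕ {z} {x} {y} cx cy = begin
    z ⊗ (x ⊕ y)     ≈⟨ distribˡ ⟩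
    z ⊗ x ⊕ z ⊗ y   ≈⟨ ⊕-cong cx cy ⟩
    x ⊗ z ⊕ y ⊗ z   ≈⟨ sym distribʳ ⟩
    (x ⊕ y) ⊗ z     ∎

  commute-⊗ : ∀ {z x y} → Commute z x → Commute z y → Commute z (x ⊗ y)
  commute-⊗ {z} {x} {y} cx cy = begin
    z ⊗ (x ⊗ y)  ≈⟨ sym ⊗-assoc ⟩
    (z ⊗ x) ⊗ y  ≈⟨ ⊗-cong cx ≈-refl ⟩
    (x ⊗ z) ⊗ y  ≈⟨ ⊗-assoc ⟩
    x ⊗ (z ⊗ y)  ≈⟨ ⊗-cong ≈-refl cy ⟩
    x ⊗ (y ⊗ z)  ≈⟨ sym ⊗-assoc ⟩
    (x ⊗ y) ⊗ z  ∎

  commute-⊝ : ∀ {z x} → Commute z x → Commute z (⊝ x)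
  commute-⊝ {z} {x} cx = begin
    z ⊗ ⊝ x    ≈⟨ -‿distribʳ-* z x ⟨
    ⊝ (z ⊗ x)  ≈⟨ ⊝-cong cx ⟩
    ⊝ (x ⊗ z)  ≈⟨ -‿distribˡ-* x z ⟩
    ⊝ x ⊗ z    ∎

  commute-inverse : ∀ {z u v} → u ⊗ v ≈ 𝟙 → v ⊗ u ≈ 𝟙 → Commute z u → Commute z v
  commute-inverse {z} {u} {v} uv vu cu = begin
    z ⊗ v                ≈⟨ ⊗-idˡ ⟨
    𝟙 ⊗ (z ⊗ v)          ≈⟨ ⊗-cong (sym vu) ≈-refl ⟩
    (v ⊗ u) ⊗ (z ⊗ v)    ≈⟨ ⊗-assoc ⟩
    v ⊗ (u ⊗ (z ⊗ v))    ≈⟨ ⊗-cong ≈-refl (sym ⊗-assoc) ⟩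
    v ⊗ ((u ⊗ z) ⊗ v)    ≈⟨ ⊗-cong ≈-refl (⊗-cong (sym cu) ≈-refl) ⟩
    v ⊗ ((z ⊗ u) ⊗ v)    ≈⟨ ⊗-cong ≈-refl ⊗-assoc ⟩
    v ⊗ (z ⊗ (u ⊗ v))    ≈⟨ ⊗-cong ≈-refl (⊗-cong ≈-refl uv) ⟩
    v ⊗ (z ⊗ 𝟙)          ≈⟨ ⊗-cong ≈-refl ⊗-idʳ ⟩
    v ⊗ z                ∎

  Central : Tm → Set
  Central z = ∀ x → Commute z x

  central-by-generators : ∀ {z} → Commute z S → Commute z U → Central z
  central-by-generators cS cU S         = cS
  central-by-generators cS cU U         = cU
  central-by-generators cS cU U⁻¹       = commute-inverse UU⁻¹ U⁻¹U cU
  central-by-generators {z} cS cU 𝟘     = commute-𝟘 z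
  central-by-generators {z} cS cU 𝟙     = commute-𝟙 z
  central-by-generators cS cU (x ⊕ y)   =
    commute-⊕ (central-by-generators cS cU x) (central-by-generators cS cU y)
  central-by-generators cS cU (x ⊗ y)   =
    commute-⊗ (central-by-generators cS cU x) (central-by-generators cS cU y)
  central-by-generators cS cU (⊝ x)     = commute-⊝ (central-by-generators cS cU x)

  unit-product : ∀ a b c d → a ⊗ b ≈ 𝟙 → c ⊗ d ≈ 𝟙 → (a ⊗ c) ⊗ (d ⊗ b) ≈ 𝟙
  unit-product a b c d ab cd = begin
    (a ⊗ c) ⊗ (d ⊗ b)  ≈⟨ ⊗-assoc ⟩
    a ⊗ (c ⊗ (d ⊗ b))  ≈⟨ ⊗-cong ≈-refl (sym ⊗-assoc) ⟩
    a ⊗ ((c ⊗ d) ⊗ b)  ≈⟨ ⊗-cong ≈-refl (⊗-cong cd ≈-refl) ⟩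
    a ⊗ (𝟙 ⊗ b)        ≈⟨ ⊗-cong ≈-refl ⊗-idˡ ⟩
    a ⊗ b              ≈⟨ ab ⟩
    𝟙                  ∎

  ζ₂ζ₂⁻¹≈1 : ζ₂ ⊗ ζ₂⁻¹ ≈ 𝟙
  ζ₂ζ₂⁻¹≈1 = unit-product U U⁻¹ U U⁻¹ UU⁻¹ UU⁻¹

  ζ₂⁻¹ζ₂≈1 : ζ₂⁻¹ ⊗ ζ₂ ≈ 𝟙
  ζ₂⁻¹ζ₂≈1 = unit-product U⁻¹ U U⁻¹ U U⁻¹U U⁻¹U

  ζ₂-central : Central ζ₂
  ζ₂-central = central-by-generators UUS ⊗-assoc

  ζ₂⁻¹-central : Central ζ₂⁻¹
  ζ₂⁻¹-central x = sym (commute-inverse ζ₂ζ₂⁻¹≈1 ζ₂⁻¹ζ₂≈1 (sym (ζ₂-central x)))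

  -- ζ₁ S = SUS = S ζ₁, since USS = 0 = SSU.
  ζ₁-commutes-S : Commute ζ₁ S
  ζ₁-commutes-S = begin
    (U ⊗ S ⊕ S ⊗ U) ⊗ S          ≈⟨ distribʳ ⟩
    (U ⊗ S) ⊗ S ⊕ (S ⊗ U) ⊗ S    ≈⟨ ⊕-cong (xSS≈0 U) ⊗-assoc ⟩
    𝟘 ⊕ S ⊗ (U ⊗ S)              ≈⟨ +-comm 𝟘 _ ⟩
    S ⊗ (U ⊗ S) ⊕ 𝟘              ≈⟨ ⊕-cong ≈-refl (SSx≈0 U) ⟨
    S ⊗ (U ⊗ S) ⊕ S ⊗ (S ⊗ U)    ≈⟨ distribˡ ⟨
    S ⊗ (U ⊗ S ⊕ S ⊗ U)          ∎

  -- ζ₁ U = USU + U²S = U ζ₁, using SU² = U²S.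
  ζ₁-commutes-U : Commute ζ₁ U
  ζ₁-commutes-U = begin
    (U ⊗ S ⊕ S ⊗ U) ⊗ U          ≈⟨ distribʳ ⟩
    (U ⊗ S) ⊗ U ⊕ (S ⊗ U) ⊗ U    ≈⟨ ⊕-cong ⊗-assoc (trans ⊗-assoc (trans (sym UUS) ⊗-assoc)) ⟩
    U ⊗ (S ⊗ U) ⊕ U ⊗ (U ⊗ S)    ≈⟨ ⊕-comm ⟩
    U ⊗ (U ⊗ S) ⊕ U ⊗ (S ⊗ U)    ≈⟨ distribˡ ⟨
    U ⊗ (U ⊗ S ⊕ S ⊗ U)          ∎

  ζ₁-central : Central ζ₁
  ζ₁-central = central-by-generators ζ₁-commutes-S ζ₁-commutes-U

  central : ∀ k → Central ⟦ k ⟧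
  central z₁         = ζ₁-central
  central z₂         = ζ₂-central
  central z₂⁻¹       = ζ₂⁻¹-central
  central z𝟘 x       = sym (commute-𝟘 x)
  central z𝟙 x       = sym (commute-𝟙 x)
  central (a z⊕ b) x = sym (commute-⊕ (sym (central a x)) (sym (central b x)))
  central (a z⊗ b) x = sym (commute-⊗ (sym (central a x)) (sym (central b x)))
  central (z⊝ a) x   = sym (commute-⊝ (sym (central a x)))

  pull-central : ∀ k x e → x ⊗ (⟦ k ⟧ ⊗ e) ≈ ⟦ k ⟧ ⊗ (x ⊗ e)
  pull-central k x e = begin
    x ⊗ (⟦ k ⟧ ⊗ e)  ≈⟨ ⊗-assoc ⟨
    (x ⊗ ⟦ k ⟧) ⊗ e  ≈⟨ ⊗-cong (sym (central k x)) ≈-refl ⟩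
    (⟦ k ⟧ ⊗ x) ⊗ e  ≈⟨ ⊗-assoc ⟩
    ⟦ k ⟧ ⊗ (x ⊗ e)  ∎

  record V : Set where
    constructor ⟨_,_,_,_⟩
    field c₀ c₁ c₂ c₃ : ZTm
  open V

  record _≋_ (v w : V) : Set where
    constructor eq4
    field
      ≋₀ : ⟦ c₀ v ⟧ ≈ ⟦ c₀ w ⟧
      ≋₁ : ⟦ c₁ v ⟧ ≈ ⟦ c₁ w ⟧
      ≋₂ : ⟦ c₂ v ⟧ ≈ ⟦ c₂ w ⟧
      ≋₃ : ⟦ c₃ v ⟧ ≈ ⟦ c₃ w ⟧

  ≋-refl : ∀ {v} → v ≋ v
  ≋-refl = eq4 ≈-refl ≈-refl ≈-refl ≈-refl

  ≋-sym : ∀ {v w} → v ≋ w → w ≋ v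
  ≋-sym (eq4 a b c d) = eq4 (sym a) (sym b) (sym c) (sym d)

  ≋-trans : ∀ {u v w} → u ≋ v → v ≋ w → u ≋ w
  ≋-trans (eq4 a b c d) (eq4 a' b' c' d') = eq4 (trans a a') (trans b b') (trans c c') (trans d d')

  infix  4 _≋_
  infixl 6 _+ᵥ_
  infix  8 -ᵥ_
  infixr 7 _·ᵥ_

  _+ᵥ_ : V → V → V
  v +ᵥ w = ⟨ c₀ v z⊕ c₀ w , c₁ v z⊕ c₁ w , c₂ v z⊕ c₂ w , c₃ v z⊕ c₃ w ⟩

  -ᵥ_ : V → V
  -ᵥ v = ⟨ z⊝ c₀ v , z⊝ c₁ v , z⊝ c₂ v , z⊝ c₃ v ⟩

  _·ᵥ_ : ZTm → V → V
  k ·ᵥ v = ⟨ k z⊗ c₀ v , k z⊗ c₁ v , k z⊗ c₂ v , k z⊗ c₃ v ⟩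

  0ᵥ e₀ e₁ e₂ e₃ : V
  0ᵥ = ⟨ z𝟘 , z𝟘 , z𝟘 , z𝟘 ⟩
  e₀ = ⟨ z𝟙 , z𝟘 , z𝟘 , z𝟘 ⟩
  e₁ = ⟨ z𝟘 , z𝟙 , z𝟘 , z𝟘 ⟩
  e₂ = ⟨ z𝟘 , z𝟘 , z𝟙 , z𝟘 ⟩
  e₃ = ⟨ z𝟘 , z𝟘 , z𝟘 , z𝟙 ⟩

  combine : V → Tm
  combine v = lin (c₀ v) (c₁ v) (c₂ v) (c₃ v)

  +ᵥ-cong : ∀ {v v' w w'} → v ≋ v' → w ≋ w' → v +ᵥ w ≋ v' +ᵥ w'
  +ᵥ-cong (eq4 a b c d) (eq4 a' b' c' d') =
    eq4 (⊕-cong a a') (⊕-cong b b') (⊕-cong c c') (⊕-cong d d')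

  -ᵥ-cong : ∀ {v v'} → v ≋ v' → -ᵥ v ≋ -ᵥ v'
  -ᵥ-cong (eq4 a b c d) = eq4 (⊝-cong a) (⊝-cong b) (⊝-cong c) (⊝-cong d)

  ·ᵥ-congʳ : ∀ k {v v'} → v ≋ v' → k ·ᵥ v ≋ k ·ᵥ v'
  ·ᵥ-congʳ k (eq4 a b c d) = eq4 (⊗-cong ≈-refl a) (⊗-cong ≈-refl b) (⊗-cong ≈-refl c) (⊗-cong ≈-refl d)

  +ᵥ-interchange : ∀ a b c d → (a +ᵥ b) +ᵥ (c +ᵥ d) ≋ (a +ᵥ c) +ᵥ (b +ᵥ d)
  +ᵥ-interchange a b c d =
    eq4 (⊕-interchange _ _ _ _) (⊕-interchange _ _ _ _) (⊕-interchange _ _ _ _) (⊕-interchange _ _ _ _)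

  -ᵥ-+ᵥ : ∀ v w → -ᵥ (v +ᵥ w) ≋ -ᵥ v +ᵥ -ᵥ w
  -ᵥ-+ᵥ v w = eq4 (sym (-‿+-comm _ _)) (sym (-‿+-comm _ _)) (sym (-‿+-comm _ _)) (sym (-‿+-comm _ _))

  ·ᵥ-+ᵥ : ∀ k v w → k ·ᵥ (v +ᵥ w) ≋ k ·ᵥ v +ᵥ k ·ᵥ w
  ·ᵥ-+ᵥ k v w = eq4 distribˡ distribˡ distribˡ distribˡ

  ·ᵥ-assoc : ∀ a b v → a ·ᵥ b ·ᵥ v ≋ (a z⊗ b) ·ᵥ v
  ·ᵥ-assoc a b v = eq4 (sym ⊗-assoc) (sym ⊗-assoc) (sym ⊗-assoc) (sym ⊗-assoc)

  ·ᵥ-unit : ∀ {k} v → ⟦ k ⟧ ≈ 𝟙 → k ·ᵥ v ≋ v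
  ·ᵥ-unit v k≈1 = eq4 one one one one
    where
    one : ∀ {x} → _ ⊗ x ≈ x
    one = trans (⊗-cong k≈1 ≈-refl) ⊗-idˡ

  basis-expansion : ∀ a b c d → ((a ·ᵥ e₀ +ᵥ b ·ᵥ e₁) +ᵥ c ·ᵥ e₂) +ᵥ d ·ᵥ e₃ ≋ ⟨ a , b , c , d ⟩
  basis-expansion a b c d = eq4
    (trans (sum₄-cong ⊗-idʳ (zeroʳ _) (zeroʳ _) (zeroʳ _))
           (solve 1 (λ x → ((x ⊞ id) ⊞ id) ⊞ id ⊜ x) refl _))
    (trans (sum₄-cong (zeroʳ _) ⊗-idʳ (zeroʳ _) (zeroʳ _))
           (solve 1 (λ x → ((id ⊞ x) ⊞ id) ⊞ id ⊜ x) refl _))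
    (trans (sum₄-cong (zeroʳ _) (zeroʳ _) ⊗-idʳ (zeroʳ _))
           (solve 1 (λ x → ((id ⊞ id) ⊞ x) ⊞ id ⊜ x) refl _))
    (trans (sum₄-cong (zeroʳ _) (zeroʳ _) (zeroʳ _) ⊗-idʳ)
           (solve 1 (λ x → ((id ⊞ id) ⊞ id) ⊞ x ⊜ x) refl _))

  -- Left multiplication by S:  S·1 = S,  S·S = 0,  S·U = SU,  S·SU = 0.
  mulS : V → V
  mulS v = ⟨ z𝟘 , c₀ v , z𝟘 , c₂ v ⟩

  -- Left multiplication by U:  U·1 = U,  U·S = ζ₁ − SU,  U·U = ζ₂,
  -- U·SU = ζ₁U − ζ₂S.
  mulU : V → V
  mulU v = ⟨ (c₁ v z⊗ z₁) z⊕ (c₂ v z⊗ z₂) , z⊝ (c₃ v z⊗ z₂) , c₀ v z⊕ (c₃ v z⊗ z₁) , z⊝ c₁ v ⟩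

  act : Tm → V → V
  act S v       = mulS v
  act U v       = mulU v
  act U⁻¹ v     = z₂⁻¹ ·ᵥ mulU v
  act 𝟘 v       = 0ᵥ
  act 𝟙 v       = v
  act (x ⊕ y) v = act x v +ᵥ act y v
  act (x ⊗ y) v = act x (act y v)
  act (⊝ x) v   = -ᵥ act x v

  mulS-cong : ∀ {v v'} → v ≋ v' → mulS v ≋ mulS v'
  mulS-cong (eq4 a b c d) = eq4 ≈-refl a ≈-refl c

  mulU-cong : ∀ {v v'} → v ≋ v' → mulU v ≋ mulU v'
  mulU-cong (eq4 a b c d) =
    eq4 (⊕-cong (⊗-cong b ≈-refl) (⊗-cong c ≈-refl)) (⊝-cong (⊗-cong d ≈-refl))
        (⊕-cong a (⊗-cong d ≈-refl)) (⊝-cong b)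

  act-cong : ∀ x {v w} → v ≋ w → act x v ≋ act x w
  act-cong S e       = mulS-cong e
  act-cong U e       = mulU-cong e
  act-cong U⁻¹ e     = ·ᵥ-congʳ z₂⁻¹ (mulU-cong e)
  act-cong 𝟘 e       = ≋-refl
  act-cong 𝟙 e       = e
  act-cong (x ⊕ y) e = +ᵥ-cong (act-cong x e) (act-cong y e)
  act-cong (x ⊗ y) e = act-cong x (act-cong y e)
  act-cong (⊝ x) e   = -ᵥ-cong (act-cong x e)

  mulU-+ᵥ : ∀ v w → mulU (v +ᵥ w) ≋ mulU v +ᵥ mulU w
  mulU-+ᵥ v w = eq4
    (trans (⊕-cong distribʳ distribʳ) (⊕-interchange _ _ _ _))
    (trans (⊝-cong distribʳ) (sym (-‿+-comm _ _)))
    (trans (⊕-cong ≈-refl distribʳ) (⊕-interchange _ _ _ _))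
    (sym (-‿+-comm _ _))

  act-+ᵥ : ∀ x v w → act x (v +ᵥ w) ≋ act x v +ᵥ act x w
  act-+ᵥ S v w       = eq4 (sym ⊕-idˡ) ≈-refl (sym ⊕-idˡ) ≈-refl
  act-+ᵥ U v w       = mulU-+ᵥ v w
  act-+ᵥ U⁻¹ v w     = ≋-trans (·ᵥ-congʳ z₂⁻¹ (mulU-+ᵥ v w)) (·ᵥ-+ᵥ z₂⁻¹ _ _)
  act-+ᵥ 𝟘 v w       = eq4 (sym ⊕-idˡ) (sym ⊕-idˡ) (sym ⊕-idˡ) (sym ⊕-idˡ)
  act-+ᵥ 𝟙 v w       = ≋-refl
  act-+ᵥ (x ⊕ y) v w = ≋-trans (+ᵥ-cong (act-+ᵥ x v w) (act-+ᵥ y v w)) (+ᵥ-interchange _ _ _ _)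
  act-+ᵥ (x ⊗ y) v w = ≋-trans (act-cong x (act-+ᵥ y v w)) (act-+ᵥ x _ _)
  act-+ᵥ (⊝ x) v w   = ≋-trans (-ᵥ-cong (act-+ᵥ x v w)) (-ᵥ-+ᵥ _ _)

  mulU-·ᵥ : ∀ k v → mulU (k ·ᵥ v) ≋ k ·ᵥ mulU v
  mulU-·ᵥ k v = eq4
    (trans (⊕-cong ⊗-assoc ⊗-assoc) (sym distribˡ))
    (trans (⊝-cong ⊗-assoc) (-‿distribʳ-* _ _))
    (trans (⊕-cong ≈-refl ⊗-assoc) (sym distribˡ))
    (-‿distribʳ-* _ _)

  mulS-·ᵥ : ∀ k v → mulS (k ·ᵥ v) ≋ k ·ᵥ mulS v
  mulS-·ᵥ k v = eq4 (sym (zeroʳ _)) ≈-refl (sym (zeroʳ _)) ≈-refl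

  -- U acting twice is scaling by ζ₂; this yields the relations U²S = SU² and UU⁻¹ = 1.
  mulU-twice : ∀ v → mulU (mulU v) ≋ z₂ ·ᵥ v
  mulU-twice ⟨ v₀ , v₁ , v₂ , v₃ ⟩ = eq4 e0 e1 e2 e3
    where
    V₀ = ⟦ v₀ ⟧
    V₁ = ⟦ v₁ ⟧
    V₂ = ⟦ v₂ ⟧
    V₃ = ⟦ v₃ ⟧
    e0 : (⊝ (V₃ ⊗ ζ₂)) ⊗ ζ₁ ⊕ (V₀ ⊕ V₃ ⊗ ζ₁) ⊗ ζ₂ ≈ ζ₂ ⊗ V₀
    e0 = begin
      (⊝ (V₃ ⊗ ζ₂)) ⊗ ζ₁ ⊕ (V₀ ⊕ V₃ ⊗ ζ₁) ⊗ ζ₂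
        ≈⟨ ⊕-cong (sym (-‿distribˡ-* _ _)) distribʳ ⟩
      ⊝ ((V₃ ⊗ ζ₂) ⊗ ζ₁) ⊕ (V₀ ⊗ ζ₂ ⊕ (V₃ ⊗ ζ₁) ⊗ ζ₂)
        ≈⟨ ⊕-cong (⊝-cong (trans ⊗-assoc (trans (⊗-cong ≈-refl (ζ₂-central ζ₁)) (sym ⊗-assoc)))) ⊕-comm ⟩
      ⊝ ((V₃ ⊗ ζ₁) ⊗ ζ₂) ⊕ ((V₃ ⊗ ζ₁) ⊗ ζ₂ ⊕ V₀ ⊗ ζ₂)
        ≈⟨ cancelˡ _ _ ⟩
      V₀ ⊗ ζ₂
        ≈⟨ ζ₂-central V₀ ⟨
      ζ₂ ⊗ V₀ ∎
    e1 : ⊝ ((⊝ V₁) ⊗ ζ₂) ≈ ζ₂ ⊗ V₁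
    e1 = trans (⊝-cong (sym (-‿distribˡ-* _ _))) (trans (-‿involutive _) (sym (ζ₂-central V₁)))
    e2 : (V₁ ⊗ ζ₁ ⊕ V₂ ⊗ ζ₂) ⊕ (⊝ V₁) ⊗ ζ₁ ≈ ζ₂ ⊗ V₂
    e2 = begin
      (V₁ ⊗ ζ₁ ⊕ V₂ ⊗ ζ₂) ⊕ (⊝ V₁) ⊗ ζ₁  ≈⟨ ⊕-cong ⊕-comm (sym (-‿distribˡ-* _ _)) ⟩
      (V₂ ⊗ ζ₂ ⊕ V₁ ⊗ ζ₁) ⊕ ⊝ (V₁ ⊗ ζ₁)  ≈⟨ cancelʳ _ _ ⟩
      V₂ ⊗ ζ₂                            ≈⟨ ζ₂-central V₂ ⟨
      ζ₂ ⊗ V₂                            ∎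
    e3 : ⊝ (⊝ (V₃ ⊗ ζ₂)) ≈ ζ₂ ⊗ V₃
    e3 = trans (-‿involutive _) (sym (ζ₂-central V₃))

  U⁻¹-undoes-U : ∀ v → z₂⁻¹ ·ᵥ mulU (mulU v) ≋ v
  U⁻¹-undoes-U v =
    ≋-trans (·ᵥ-congʳ z₂⁻¹ (mulU-twice v)) (≋-trans (·ᵥ-assoc z₂⁻¹ z₂ v) (·ᵥ-unit v ζ₂⁻¹ζ₂≈1))

  act-ζ₁ : ∀ v → act ζ₁ v ≋ z₁ ·ᵥ v
  act-ζ₁ ⟨ v₀ , v₁ , v₂ , v₃ ⟩ = eq4 e0 e1 e2 e3
    where
    V₀ = ⟦ v₀ ⟧
    V₁ = ⟦ v₁ ⟧
    V₂ = ⟦ v₂ ⟧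
    V₃ = ⟦ v₃ ⟧
    e0 : (V₀ ⊗ ζ₁ ⊕ 𝟘 ⊗ ζ₂) ⊕ 𝟘 ≈ ζ₁ ⊗ V₀
    e0 = trans (+-identityʳ _) (trans (⊕-cong ≈-refl (zeroˡ _)) (trans (+-identityʳ _) (sym (ζ₁-central V₀))))
    e1 : ⊝ (V₂ ⊗ ζ₂) ⊕ (V₁ ⊗ ζ₁ ⊕ V₂ ⊗ ζ₂) ≈ ζ₁ ⊗ V₁
    e1 = trans (⊕-cong ≈-refl ⊕-comm) (trans (cancelˡ _ _) (sym (ζ₁-central V₁)))
    e2 : (𝟘 ⊕ V₂ ⊗ ζ₁) ⊕ 𝟘 ≈ ζ₁ ⊗ V₂
    e2 = trans (+-identityʳ _) (trans ⊕-idˡ (sym (ζ₁-central V₂)))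
    e3 : ⊝ V₀ ⊕ (V₀ ⊕ V₃ ⊗ ζ₁) ≈ ζ₁ ⊗ V₃
    e3 = trans (cancelˡ _ _) (sym (ζ₁-central V₃))

  act-central : ∀ k v → act ⟦ k ⟧ v ≋ k ·ᵥ v
  act-central z₁ v       = act-ζ₁ v
  act-central z₂ v       = mulU-twice v
  act-central z₂⁻¹ v     = ≋-trans (·ᵥ-congʳ z₂⁻¹ (mulU-·ᵥ z₂⁻¹ _)) (·ᵥ-congʳ z₂⁻¹ (U⁻¹-undoes-U v))
  act-central z𝟘 v       = eq4 (sym (zeroˡ _)) (sym (zeroˡ _)) (sym (zeroˡ _)) (sym (zeroˡ _))
  act-central z𝟙 v       = eq4 (sym ⊗-idˡ) (sym ⊗-idˡ) (sym ⊗-idˡ) (sym ⊗-idˡ)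
  act-central (a z⊕ b) v =
    ≋-trans (+ᵥ-cong (act-central a v) (act-central b v))
            (eq4 (sym distribʳ) (sym distribʳ) (sym distribʳ) (sym distribʳ))
  act-central (a z⊗ b) v =
    ≋-trans (act-cong ⟦ a ⟧ (act-central b v)) (≋-trans (act-central a _) (·ᵥ-assoc a b v))
  act-central (z⊝ a) v   =
    ≋-trans (-ᵥ-cong (act-central a v))
            (eq4 (-‿distribˡ-* _ _) (-‿distribˡ-* _ _) (-‿distribˡ-* _ _) (-‿distribˡ-* _ _))

  natZ : ℕ → ZTm
  natZ zero    = z𝟘
  natZ (suc n) = z𝟙 z⊕ natZ n

  ⟦natZ⟧ : ∀ n → ⟦ natZ n ⟧ ≡ nat n
  ⟦natZ⟧ zero    = ≡.refl
  ⟦natZ⟧ (suc n) = ≡.cong (𝟙 ⊕_) (⟦natZ⟧ n)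

  act-char : ∀ v → act (nat p) v ≋ 0ᵥ
  act-char v = ≡.subst (λ t → act t v ≋ 0ᵥ) (⟦natZ⟧ p)
    (≋-trans (act-central (natZ p) v) (eq4 kills kills kills kills))
    where
    p≈0 : ⟦ natZ p ⟧ ≈ 𝟘
    p≈0 = ≡.subst (λ t → t ≈ 𝟘) (≡.sym (⟦natZ⟧ p)) char
    kills : ∀ {x} → ⟦ natZ p ⟧ ⊗ x ≈ 𝟘
    kills {x} = trans (⊗-cong p≈0 ≈-refl) (zeroˡ x)

  act-resp : ∀ {x y} → x ≈[ p ] y → ∀ v → act x v ≋ act y v
  act-resp ≈-refl v          = ≋-refl
  act-resp (≈-sym e) v       = ≋-sym (act-resp e v)
  act-resp (≈-trans e f) v   = ≋-trans (act-resp e v) (act-resp f v)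
  act-resp (⊕-cong e f) v    = +ᵥ-cong (act-resp e v) (act-resp f v)
  act-resp (⊗-cong {x = x} {y' = y'} e f) v =
    ≋-trans (act-cong x (act-resp f v)) (act-resp e (act y' v))
  act-resp (⊝-cong e) v      = -ᵥ-cong (act-resp e v)
  act-resp ⊕-assoc v         = eq4 ⊕-assoc ⊕-assoc ⊕-assoc ⊕-assoc
  act-resp ⊕-comm v          = eq4 ⊕-comm ⊕-comm ⊕-comm ⊕-comm
  act-resp ⊕-idˡ v           = eq4 ⊕-idˡ ⊕-idˡ ⊕-idˡ ⊕-idˡ
  act-resp ⊝-invˡ v          = eq4 ⊝-invˡ ⊝-invˡ ⊝-invˡ ⊝-invˡ
  act-resp ⊗-assoc v         = ≋-refl
  act-resp ⊗-idˡ v           = ≋-refl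
  act-resp ⊗-idʳ v           = ≋-refl
  act-resp (distribˡ {x = x} {y = y} {z = z}) v = act-+ᵥ x (act y v) (act z v)
  act-resp distribʳ v        = ≋-refl
  act-resp char v            = act-char v
  act-resp UU⁻¹ v            = ≋-trans (mulU-·ᵥ z₂⁻¹ (mulU v)) (U⁻¹-undoes-U v)
  act-resp U⁻¹U v            = U⁻¹-undoes-U v
  act-resp SS v              = ≋-refl
  act-resp UUS v             =
    ≋-trans (mulU-twice _) (≋-sym (≋-trans (mulS-cong (mulU-twice v)) (mulS-·ᵥ z₂ v)))

  combine-+ᵥ : ∀ v w → combine (v +ᵥ w) ≈ combine v ⊕ combine w
  combine-+ᵥ v w = trans (sum₄-cong distribʳ distribʳ distribʳ distribʳ)
    (solve 8 (λ a₀ b₀ a₁ b₁ a₂ b₂ a₃ b₃ →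
                (((a₀ ⊞ b₀) ⊞ (a₁ ⊞ b₁)) ⊞ (a₂ ⊞ b₂)) ⊞ (a₃ ⊞ b₃)
              ⊜ ((((a₀ ⊞ a₁) ⊞ a₂) ⊞ a₃) ⊞ (((b₀ ⊞ b₁) ⊞ b₂) ⊞ b₃))) refl _ _ _ _ _ _ _ _)

  combine--ᵥ : ∀ v → combine (-ᵥ v) ≈ ⊝ combine v
  combine--ᵥ v = begin
    combine (-ᵥ v)
      ≈⟨ sum₄-cong (neg _) (neg _) (neg _) (neg _) ⟩
    ((⊝ a ⊕ ⊝ b) ⊕ ⊝ c) ⊕ ⊝ d
      ≈⟨ ⊕-cong (⊕-cong (-‿+-comm a b) ≈-refl) ≈-refl ⟩
    (⊝ (a ⊕ b) ⊕ ⊝ c) ⊕ ⊝ d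
      ≈⟨ ⊕-cong (-‿+-comm (a ⊕ b) c) ≈-refl ⟩
    ⊝ ((a ⊕ b) ⊕ c) ⊕ ⊝ d
      ≈⟨ -‿+-comm ((a ⊕ b) ⊕ c) d ⟩
    ⊝ combine v ∎
    where
    neg : ∀ x {y} → ⊝ x ⊗ y ≈ ⊝ (x ⊗ y)
    neg x {y} = sym (-‿distribˡ-* x y)
    a = ⟦ c₀ v ⟧ ⊗ 𝟙
    b = ⟦ c₁ v ⟧ ⊗ S
    c = ⟦ c₂ v ⟧ ⊗ U
    d = ⟦ c₃ v ⟧ ⊗ (S ⊗ U)

  combine-0ᵥ : combine 0ᵥ ≈ 𝟘
  combine-0ᵥ = trans (sum₄-cong (zeroˡ _) (zeroˡ _) (zeroˡ _) (zeroˡ _))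
                     (solve 0 (((id ⊞ id) ⊞ id) ⊞ id ⊜ id) refl)

  combine-e₀ : combine e₀ ≈ 𝟙
  combine-e₀ = trans (sum₄-cong ⊗-idʳ (zeroˡ _) (zeroˡ _) (zeroˡ _))
                     (solve 1 (λ x → ((x ⊞ id) ⊞ id) ⊞ id ⊜ x) refl 𝟙)

  combine-·ᵥ : ∀ k v → combine (k ·ᵥ v) ≈ ⟦ k ⟧ ⊗ combine v
  combine-·ᵥ k v = trans (sum₄-cong ⊗-assoc ⊗-assoc ⊗-assoc ⊗-assoc) (sym (distrib₄ _ _ _ _ _))

  left-multiply : ∀ x v → x ⊗ combine v ≈
    ((⟦ c₀ v ⟧ ⊗ (x ⊗ 𝟙) ⊕ ⟦ c₁ v ⟧ ⊗ (x ⊗ S)) ⊕ ⟦ c₂ v ⟧ ⊗ (x ⊗ U)) ⊕ ⟦ c₃ v ⟧ ⊗ (x ⊗ (S ⊗ U))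
  left-multiply x v = trans (distrib₄ _ _ _ _ _)
    (sum₄-cong (pull-central (c₀ v) x 𝟙) (pull-central (c₁ v) x S)
               (pull-central (c₂ v) x U) (pull-central (c₃ v) x (S ⊗ U)))

  combine-mulS : ∀ v → combine (mulS v) ≈ S ⊗ combine v
  combine-mulS v = sym (begin
    S ⊗ combine v
      ≈⟨ left-multiply S v ⟩
    _ ≈⟨ sum₄-cong (⊗-cong ≈-refl ⊗-idʳ) (trans (⊗-cong ≈-refl SS) (zeroʳ _)) ≈-refl
                   (trans (⊗-cong ≈-refl (SSx≈0 U)) (zeroʳ _)) ⟩
    ((a ⊕ 𝟘) ⊕ c) ⊕ 𝟘
      ≈⟨ solve 2 (λ a c → ((a ⊞ id) ⊞ c) ⊞ id ⊜ ((id ⊞ a) ⊞ id) ⊞ c) refl a c ⟩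
    ((𝟘 ⊕ a) ⊕ 𝟘) ⊕ c
      ≈⟨ sum₄-cong (zeroˡ _) ≈-refl (zeroˡ _) ≈-refl ⟨
    combine (mulS v) ∎)
    where
    a = ⟦ c₀ v ⟧ ⊗ S
    c = ⟦ c₂ v ⟧ ⊗ (S ⊗ U)

  U·S : U ⊗ S ≈ ζ₁ ⊕ ⊝ (S ⊗ U)
  U·S = sym (cancelʳ _ _)

  U·SU : U ⊗ (S ⊗ U) ≈ ζ₁ ⊗ U ⊕ ⊝ (ζ₂ ⊗ S)
  U·SU = begin
    U ⊗ (S ⊗ U)               ≈⟨ ⊗-assoc ⟨
    (U ⊗ S) ⊗ U               ≈⟨ ⊗-cong U·S ≈-refl ⟩
    (ζ₁ ⊕ ⊝ (S ⊗ U)) ⊗ U      ≈⟨ distribʳ ⟩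
    ζ₁ ⊗ U ⊕ ⊝ (S ⊗ U) ⊗ U    ≈⟨ ⊕-cong ≈-refl (-‿distribˡ-* _ _) ⟨
    ζ₁ ⊗ U ⊕ ⊝ ((S ⊗ U) ⊗ U)  ≈⟨ ⊕-cong ≈-refl (⊝-cong (trans ⊗-assoc (sym UUS))) ⟩
    ζ₁ ⊗ U ⊕ ⊝ (ζ₂ ⊗ S)       ∎

  combine-mulU : ∀ v → combine (mulU v) ≈ U ⊗ combine v
  combine-mulU v = sym (begin
    U ⊗ combine v
      ≈⟨ left-multiply U v ⟩
    _ ≈⟨ sum₄-cong (⊗-cong ≈-refl ⊗-idʳ) (⊗-cong ≈-refl U·S) ≈-refl (⊗-cong ≈-refl U·SU) ⟩
    _ ≈⟨ sum₄-cong ≈-refl (trans distribˡ (⊕-cong ≈-refl (sym (-‿distribʳ-* _ _)))) ≈-refl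
                   (trans distribˡ (⊕-cong ≈-refl (sym (-‿distribʳ-* _ _)))) ⟩
    ((a ⊕ (b ⊕ c)) ⊕ d) ⊕ (e ⊕ f)
      ≈⟨ solve 6 (λ a b c d e f →
                   ((a ⊞ (b ⊞ c)) ⊞ d) ⊞ (e ⊞ f) ⊜ (((b ⊞ d) ⊞ f) ⊞ (a ⊞ e)) ⊞ c)
                 refl a b c d e f ⟩
    (((b ⊕ d) ⊕ f) ⊕ (a ⊕ e)) ⊕ c
      ≈⟨ sum₄-cong ⊗-idʳ
                   (trans (sym (-‿distribˡ-* _ _)) (⊝-cong ⊗-assoc))
                   (trans distribʳ (⊕-cong ≈-refl ⊗-assoc))
                   (sym (-‿distribˡ-* _ _)) ⟨
    combine (mulU v) ∎)
    where
    a = ⟦ c₀ v ⟧ ⊗ U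
    b = ⟦ c₁ v ⟧ ⊗ ζ₁
    c = ⊝ (⟦ c₁ v ⟧ ⊗ (S ⊗ U))
    d = ⟦ c₂ v ⟧ ⊗ ζ₂
    e = ⟦ c₃ v ⟧ ⊗ (ζ₁ ⊗ U)
    f = ⊝ (⟦ c₃ v ⟧ ⊗ (ζ₂ ⊗ S))

  ζ₂⁻¹U≈U⁻¹ : ζ₂⁻¹ ⊗ U ≈ U⁻¹
  ζ₂⁻¹U≈U⁻¹ = trans ⊗-assoc (trans (⊗-cong ≈-refl U⁻¹U) ⊗-idʳ)

  combine-act : ∀ h v → combine (act h v) ≈ h ⊗ combine v
  combine-act S v       = combine-mulS v
  combine-act U v       = combine-mulU v
  combine-act U⁻¹ v     = begin
    combine (z₂⁻¹ ·ᵥ mulU v)  ≈⟨ combine-·ᵥ z₂⁻¹ (mulU v) ⟩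
    ζ₂⁻¹ ⊗ combine (mulU v)   ≈⟨ ⊗-cong ≈-refl (combine-mulU v) ⟩
    ζ₂⁻¹ ⊗ (U ⊗ combine v)    ≈⟨ ⊗-assoc ⟨
    (ζ₂⁻¹ ⊗ U) ⊗ combine v    ≈⟨ ⊗-cong ζ₂⁻¹U≈U⁻¹ ≈-refl ⟩
    U⁻¹ ⊗ combine v           ∎
  combine-act 𝟘 v       = trans combine-0ᵥ (sym (zeroˡ _))
  combine-act 𝟙 v       = sym ⊗-idˡ
  combine-act (x ⊕ y) v =
    trans (combine-+ᵥ _ _) (trans (⊕-cong (combine-act x v) (combine-act y v)) (sym distribʳ))
  combine-act (x ⊗ y) v =
    trans (combine-act x (act y v)) (trans (⊗-cong ≈-refl (combine-act y v)) (sym ⊗-assoc))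
  combine-act (⊝ x) v   =
    trans (combine--ᵥ _) (trans (⊝-cong (combine-act x v)) (-‿distribˡ-* _ _))

  -- Every element is a Z-combination of 1, S, U, SU: the coordinates of act h e₀.
  span : (h : Tm) → Σ ZTm λ a → Σ ZTm λ b → Σ ZTm λ c → Σ ZTm λ d → h ≈ lin a b c d
  span h = c₀ w , c₁ w , c₂ w , c₃ w , (begin
    h                       ≈⟨ ⊗-idʳ ⟨
    h ⊗ 𝟙                   ≈⟨ ⊗-cong ≈-refl combine-e₀ ⟨
    h ⊗ combine e₀          ≈⟨ combine-act h e₀ ⟨
    combine w               ∎)
    where
    w = act h e₀

  mulU-e₀ : mulU e₀ ≋ e₂
  mulU-e₀ = eq4 (trans (⊕-cong (zeroˡ _) (zeroˡ _)) ⊕-idˡ) (trans (⊝-cong (zeroˡ _)) -0#≈0#)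
                (trans (⊕-cong ≈-refl (zeroˡ _)) (+-identityʳ _)) -0#≈0#

  act-lin-e₀ : ∀ a b c d → act (lin a b c d) e₀ ≋ ⟨ a , b , c , d ⟩
  act-lin-e₀ a b c d = ≋-trans
    (+ᵥ-cong (+ᵥ-cong (+ᵥ-cong (act-central a e₀) (act-central b e₁))
                      (≋-trans (act-central c _) (·ᵥ-congʳ c mulU-e₀)))
             (≋-trans (act-central d _) (·ᵥ-congʳ d (mulS-cong mulU-e₀))))
    (basis-expansion a b c d)

  -- Independence: a vanishing combination has vanishing coefficients,
  -- since acting with it on e₀ gives both ⟨ a , b , c , d ⟩ and 0ᵥ.
  independent : (a b c d : ZTm) → lin a b c d ≈ 𝟘 →
                (⟦ a ⟧ ≈ 𝟘) × (⟦ b ⟧ ≈ 𝟘) × (⟦ c ⟧ ≈ 𝟘) × (⟦ d ⟧ ≈ 𝟘)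
  independent a b c d rel with ≋-trans (≋-sym (act-lin-e₀ a b c d)) (act-resp rel e₀)
  ... | eq4 a≈0 b≈0 c≈0 d≈0 = a≈0 , b≈0 , c≈0 , d≈0

mainTheorem7 : (p : ℕ) → Prime p → p ≢ 2 →
    ((h : Tm) → Σ ZTm λ a → Σ ZTm λ b → Σ ZTm λ c → Σ ZTm λ d →
        h ≈[ p ] lin a b c d)
    × ((a b c d : ZTm) → lin a b c d ≈[ p ] 𝟘 →
        (⟦ a ⟧ ≈[ p ] 𝟘) × (⟦ b ⟧ ≈[ p ] 𝟘) × (⟦ c ⟧ ≈[ p ] 𝟘) × (⟦ d ⟧ ≈[ p ] 𝟘))
mainTheorem7 p _ _ = Hnil.span p , Hnil.independent p
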